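{- Let $\ell\ge 1$ and define recursively $(a_0,b_0)=(\ell+1,2\ell+2)$ and, for $n\ge 1$, $a_n=\mathrm{mex}(\{a_i,b_i: i<n\}\cup\{0,1,\dots,\ell\})$, $b_n=a_n+n+\ell+1$. Then \[ \lim_{n\to\infty}\frac{a_n}{n}=\phi\qquad\text{and}\qquad\lim_{n\to\infty}\frac{b_n}{n}=\phi^2 . \]
   Context: $\phi=(1+\sqrt5)/2$ and $\mathrm{mex}\,S=\min(\mathbb{N}\setminus S)$. -}

module Defs where

open import Data.Nat using (ℕ; zero; suc; _+_; _*_; _≤_; _<_; _≥_)
open import Data.Product using (Σ; _×_; ∃-syntax)
open import Data.Sum using (_⊎_)
open import Relation.Binary.PropositionalEquality using (_≡_)
open import Relation.Nullary using (¬_)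

InS : ℕ → (ℕ → ℕ) → (ℕ → ℕ) → ℕ → ℕ → Set
InS ℓ a b n m = m ≤ ℓ ⊎ (∃[ i ] (i < n × (m ≡ a i ⊎ m ≡ b i)))

IsMex : ℕ → (ℕ → ℕ) → (ℕ → ℕ) → ℕ → ℕ → Set
IsMex ℓ a b n m = ¬ InS ℓ a b n m × (∀ k → k < m → InS ℓ a b n k)

IsSeq : ℕ → (ℕ → ℕ) → (ℕ → ℕ) → Set
IsSeq ℓ a b =
  (a 0 ≡ ℓ + 1) × (b 0 ≡ 2 * ℓ + 2) ×
  (∀ n → n ≥ 1 → IsMex ℓ a b n (a n) × (b n ≡ a n + n + ℓ + 1))

Eventually : (ℕ → Set) → Set
Eventually P = ∃[ N ] (∀ n → n ≥ N → P n)

-- A real number α > 0 is represented by its Dedekind cut on positive rationals p/q: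
-- Lower p q  ⇔  p/q < α ,  Upper p q  ⇔  p/q > α   (for q ≥ 1).
-- x n / n → α  iff for every rational p/q < α eventually x n / n > p/q
-- and for every rational p/q > α eventually x n / n < p/q.
RatioTendsTo : (ℕ → ℕ) → (ℕ → ℕ → Set) → (ℕ → ℕ → Set) → Set
RatioTendsTo x Lower Upper =
  ∀ p q → q ≥ 1 →
    (Lower p q → Eventually (λ n → p * n < q * x n)) ×
    (Upper p q → Eventually (λ n → q * x n < p * n))

-- φ = (1+√5)/2 is the positive root of t² = t + 1; for p,q ≥ 0, q ≥ 1:
-- p/q < φ ⇔ p² < pq + q² ,  p/q > φ ⇔ p² > pq + q².
PhiLower PhiUpper : ℕ → ℕ → Set
PhiLower p q = p * p < p * q + q * q
PhiUpper p q = p * q + q * q < p * p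

-- φ² = (3+√5)/2 is the larger root of t² − 3t + 1 (other root (3−√5)/2 < 3/2 < φ²);
-- for r,s ≥ 0, s ≥ 1:
-- r/s < φ² ⇔ 2r ≤ 3s or r² + s² < 3rs ;  r/s > φ² ⇔ 2r > 3s and r² + s² > 3rs.
Phi2Lower Phi2Upper : ℕ → ℕ → Set
Phi2Lower r s = 2 * r ≤ 3 * s ⊎ r * r + s * s < 3 * r * s
Phi2Upper r s = 3 * s < 2 * r × 3 * r * s < r * r + s * s

{-# OPTIONS --safe #-}
module Submission where

-- Since a is the mex sequence and b n − a n = n + ℓ + 1 grows, a and b are increasing and
-- complementary above ℓ, so a n = n + ℓ + 1 + k, where k is the number of values of b below
-- a n. Hence an upper bound a n ≲ (q / r) n gives the lower bound a n ≳ (1 + r / q) n, and a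
-- lower bound gives an upper one in the same way. Since φ = 1 + 1 / φ, this is the Euclid step
-- p / q ↦ q / (p − q) of the continued fraction of φ, so starting from n ≤ a n ≤ 2 n + O(1)
-- every rational below (above) φ becomes a lower (upper) bound of a n / n up to O(1 / n).
-- Passing to a slightly better rational makes the bounds strict for large n, and
-- b n / n = a n / n + 1 + O(1 / n) then tends to φ + 1 = φ².

open import Defs
open import Data.List using ([]; _∷_)
open import Data.Nat
open import Data.Nat.Properties
open import Data.Nat.Tactic.RingSolver
open import Data.Product using (_×_; _,_; proj₁; proj₂; ∃-syntax)
open import Data.Sum using (inj₁; inj₂)
open import Relation.Binary.Definitions using (tri<; tri≈; tri>)
open import Relation.Binary.PropositionalEquality
open import Relation.Nullary using (¬_; yes; no; contradiction)

StrictlyIncreasing : (ℕ → ℕ) → Set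
StrictlyIncreasing f = ∀ n → f n < f (suc n)

module _ {f : ℕ → ℕ} (inc : StrictlyIncreasing f) where

  increasing-≤ : ∀ {i j} → i ≤ j → f i ≤ f j
  increasing-≤ {j = zero}  z≤n = ≤-refl
  increasing-≤ {j = suc j} i≤1+j with m≤n⇒m<n∨m≡n i≤1+j
  ... | inj₁ (s≤s i≤j) = ≤-trans (increasing-≤ i≤j) (<⇒≤ (inc j))
  ... | inj₂ refl      = ≤-refl

  increasing-< : ∀ {i j} → i < j → f i < f j
  increasing-< {j = suc j} (s≤s i≤j) = ≤-<-trans (increasing-≤ i≤j) (inc j)

Rank : (ℕ → ℕ) → ℕ → ℕ → Set
Rank b k x = (∀ j → j < k → b j < x) × x ≤ b k

rank-skip : ∀ {b k x} → Rank b k x → x ≢ b k → Rank b k (suc x)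
rank-skip (below , x≤bk) x≢bk = (λ j j<k → m<n⇒m<1+n (below j j<k)) , ≤∧≢⇒< x≤bk x≢bk

module _ {b : ℕ → ℕ} (inc : StrictlyIncreasing b) where

  rank-index : ∀ {k i} → Rank b k (b i) → i ≡ k
  rank-index {k} {i} (below , bi≤bk) with <-cmp i k
  ... | tri< i<k _ _ = contradiction (below i i<k) (n≮n (b i))
  ... | tri≈ _ i≡k _ = i≡k
  ... | tri> _ _ k<i = contradiction (increasing-< inc k<i) (≤⇒≯ bi≤bk)

  rank-suc : ∀ {k x i} → Rank b k x → x ≡ b i → Rank b (suc k) (suc x)
  rank-suc {k} rank refl with rank-index rank
  ... | refl = (λ j j≤k → s≤s (increasing-≤ inc (≤-pred j≤k))) , inc k

  rank-fill : ∀ {k x z} → (∀ y → x ≤ y → y < z → ∃[ i ] y ≡ b i) →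
              Rank b k x → ∀ t → t + x ≤ z → Rank b (t + k) (t + x)
  rank-fill covered rank zero    _      = rank
  rank-fill {x = x} covered rank (suc t) t+x<z =
    rank-suc (rank-fill covered rank t (<⇒≤ t+x<z)) (proj₂ (covered (t + x) (m≤n+m x t) t+x<z))

LinearLowerBound LinearUpperBound : (ℕ → ℕ) → ℕ → ℕ → Set
LinearLowerBound x p q = ∃[ C ] ∀ n → p * n ≤ q * x n + C
LinearUpperBound x p q = ∃[ D ] ∀ n → q * x n ≤ p * n + D

module _ {x : ℕ → ℕ} (p q : ℕ) where
  open ≤-Reasoning

  lowerBound⇒eventually-< : ∀ m → LinearLowerBound x (p * m + 1) (q * m) →
                             Eventually (λ n → p * n < q * x n)
  lowerBound⇒eventually-< m (C , bound) = suc C , λ n C<n → below (x n) C<n (bound n)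
    where
    below : ∀ {n} X → C < n → (p * m + 1) * n ≤ q * m * X + C → p * n < q * X
    below {n} X C<n le = *-cancelˡ-< m (p * n) (q * X) (+-cancelʳ-< C _ _ (begin-strict
      m * (p * n) + C    <⟨ +-monoʳ-< (m * (p * n)) C<n ⟩
      m * (p * n) + n    ≡⟨ solve (m ∷ p ∷ n ∷ []) ⟩
      (p * m + 1) * n    ≤⟨ le ⟩
      q * m * X + C      ≡⟨ solve (q ∷ m ∷ X ∷ C ∷ []) ⟩
      m * (q * X) + C    ∎))

  upperBound⇒eventually-< : ∀ m → (∀ n → n ≤ x n) → LinearUpperBound x (p * m) (q * m + 1) →
                             ∀ E → Eventually (λ n → q * x n + E < p * n)
  upperBound⇒eventually-< m n≤x (D , bound) E =
    suc (m * E + D) , λ n mE+D<n → above (x n) (<-≤-trans mE+D<n (n≤x n)) (bound n)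
    where
    above : ∀ {n} X → m * E + D < X → (q * m + 1) * X ≤ p * m * n + D → q * X + E < p * n
    above {n} X mE+D<X le = *-cancelˡ-< m (q * X + E) (p * n) (+-cancelʳ-< D _ _ (begin-strict
      m * (q * X + E) + D    ≡⟨ solve (m ∷ q ∷ X ∷ E ∷ D ∷ []) ⟩
      m * (q * X) + (m * E + D) <⟨ +-monoʳ-< (m * (q * X)) mE+D<X ⟩
      m * (q * X) + X        ≡⟨ solve (m ∷ q ∷ X ∷ []) ⟩
      (q * m + 1) * X        ≤⟨ le ⟩
      p * m * n + D          ≡⟨ solve (p ∷ m ∷ n ∷ D ∷ []) ⟩
      m * (p * n) + D        ∎))

phiLower⇒0<q : ∀ p q → PhiLower p q → 0 < q
phiLower⇒0<q p zero    lt = contradiction (subst (λ z → p * p < z + 0) (*-zeroʳ p) lt) (λ ())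
phiLower⇒0<q _ (suc _) _  = z<s

phiUpper⇒< : ∀ p q → PhiUpper p q → q < p
phiUpper⇒< p q gt = ≰⇒> λ p≤q → <⇒≱ gt (≤-trans (*-monoʳ-≤ p p≤q) (m≤m+n (p * q) (q * q)))

phiLower-sharpen : ∀ p q m → p + p < m → PhiLower p q → PhiLower (p * m + 1) (q * m)
phiLower-sharpen p q m p+p<m lt = begin
  suc ((p * m + 1) * (p * m + 1))      ≡⟨ solve (p ∷ m ∷ []) ⟩
  (p + p) * m + 2 + p * p * (m * m)    ≤⟨ +-monoˡ-≤ (p * p * (m * m)) slack ⟩
  m * m + q * m + p * p * (m * m)      ≡⟨ solve (p ∷ q ∷ m ∷ []) ⟩
  suc (p * p) * (m * m) + q * m        ≤⟨ +-monoˡ-≤ (q * m) (*-monoˡ-≤ (m * m) lt) ⟩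
  (p * q + q * q) * (m * m) + q * m    ≡⟨ solve (p ∷ q ∷ m ∷ []) ⟩
  (p * m + 1) * (q * m) + q * m * (q * m) ∎
  where
  open ≤-Reasoning
  0<m : 0 < m
  0<m = <-≤-trans z<s p+p<m
  0<q : 0 < q
  0<q = phiLower⇒0<q p q lt
  slack : (p + p) * m + 2 ≤ m * m + q * m
  slack = begin
    (p + p) * m + 2             ≤⟨ +-monoʳ-≤ ((p + p) * m) (+-mono-≤ 0<m (*-mono-≤ 0<q 0<m)) ⟩
    (p + p) * m + (m + q * m)   ≡⟨ solve (p ∷ q ∷ m ∷ []) ⟩
    suc (p + p) * m + q * m     ≤⟨ +-monoˡ-≤ (q * m) (*-monoˡ-≤ m p+p<m) ⟩
    m * m + q * m               ∎

phiUpper-sharpen : ∀ p q m → p + q + q < m → PhiUpper p q → PhiUpper (p * m) (q * m + 1)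
phiUpper-sharpen p q m p+2q<m gt = begin
  suc (p * m * (q * m + 1) + (q * m + 1) * (q * m + 1)) ≡⟨ solve (p ∷ q ∷ m ∷ []) ⟩
  (p * q + q * q) * (m * m) + ((p + q + q) * m + 2)    ≤⟨ +-monoʳ-≤ ((p * q + q * q) * (m * m)) slack ⟩
  (p * q + q * q) * (m * m) + m * m                    ≡⟨ solve (p ∷ q ∷ m ∷ []) ⟩
  suc (p * q + q * q) * (m * m)                        ≤⟨ *-monoˡ-≤ (m * m) gt ⟩
  p * p * (m * m)                                      ≡⟨ solve (p ∷ m ∷ []) ⟩
  p * m * (p * m)                                      ∎
  where
  open ≤-Reasoning
  0<p : 0 < p
  0<p = <-≤-trans z<s (phiUpper⇒< p q gt)
  2≤m : 2 ≤ m
  2≤m = ≤-trans (s≤s (≤-trans 0<p (≤-trans (m≤m+n p q) (m≤m+n (p + q) q)))) p+2q<m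
  slack : (p + q + q) * m + 2 ≤ m * m
  slack = begin
    (p + q + q) * m + 2   ≤⟨ +-monoʳ-≤ ((p + q + q) * m) 2≤m ⟩
    (p + q + q) * m + m   ≡⟨ +-comm ((p + q + q) * m) m ⟩
    suc (p + q + q) * m   ≤⟨ *-monoˡ-≤ m p+2q<m ⟩
    m * m                 ∎

-- Since φ = 1 + 1 / φ, (q + r) / q < φ iff q / r > φ.
phiLower-euclid : ∀ q r → PhiLower (q + r) q → PhiUpper q r
phiLower-euclid q r lt = +-cancelʳ-< (q * q + q * r) (q * r + r * r) (q * q) (begin-strict
  q * r + r * r + (q * q + q * r) ≡⟨ solve (q ∷ r ∷ []) ⟩
  (q + r) * (q + r)               <⟨ lt ⟩
  (q + r) * q + q * q             ≡⟨ solve (q ∷ r ∷ []) ⟩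
  q * q + (q * q + q * r)         ∎)
  where open ≤-Reasoning

phiUpper-euclid : ∀ q r → PhiUpper (q + r) q → PhiLower q r
phiUpper-euclid q r gt = +-cancelʳ-< (q * q + q * r) (q * q) (q * r + r * r) (begin-strict
  q * q + (q * q + q * r)         ≡⟨ solve (q ∷ r ∷ []) ⟩
  (q + r) * q + q * q             <⟨ gt ⟩
  (q + r) * (q + r)               ≡⟨ solve (q ∷ r ∷ []) ⟩
  q * r + r * r + (q * q + q * r) ∎)
  where open ≤-Reasoning

-- Since φ² = 1 + φ, r / s < φ² iff (r − s) / s < φ.
phi2Lower⇒phiLower : ∀ r s → 0 < s → Phi2Lower r s → ∃[ t ] r ≤ s + t × PhiLower t s
phi2Lower⇒phiLower r s 0<s lt with r ≤? s
... | yes r≤s = 0 , ≤-trans r≤s (m≤m+n s 0) , *-mono-< 0<s 0<s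
... | no r≰s with m≤n⇒∃[o]m+o≡n (<⇒≤ (≰⇒> r≰s))
... | t , refl = t , ≤-refl , phiLower-from lt
  where
  open ≤-Reasoning
  phiLower-from : Phi2Lower (s + t) s → PhiLower t s
  phiLower-from (inj₁ 2r≤3s) = begin-strict
    t * t         ≤⟨ *-monoʳ-≤ t (≤-trans (m≤m+n t t) 2t≤s) ⟩
    t * s         <⟨ m<m+n (t * s) (*-mono-< 0<s 0<s) ⟩
    t * s + s * s ∎
    where
    2t≤s : t + t ≤ s
    2t≤s = +-cancelˡ-≤ (s + s) (t + t) s (begin
      s + s + (t + t) ≡⟨ solve (s ∷ t ∷ []) ⟩
      2 * (s + t)     ≤⟨ 2r≤3s ⟩
      3 * s           ≡⟨ solve (s ∷ []) ⟩
      s + s + s       ∎)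
  phiLower-from (inj₂ lt) =
    +-cancelʳ-< (s * s + s * s + s * t + s * t) (t * t) (t * s + s * s) (begin-strict
    t * t + (s * s + s * s + s * t + s * t)         ≡⟨ solve (s ∷ t ∷ []) ⟩
    (s + t) * (s + t) + s * s                       <⟨ lt ⟩
    3 * (s + t) * s                                 ≡⟨ solve (s ∷ t ∷ []) ⟩
    t * s + s * s + (s * s + s * s + s * t + s * t) ∎)

phi2Upper⇒phiUpper : ∀ r s → Phi2Upper r s → ∃[ t ] s + t ≤ r × PhiUpper t s
phi2Upper⇒phiUpper r s (3s<2r , gt) with m≤n⇒∃[o]m+o≡n s≤r
  where
  s≤r : s ≤ r
  s≤r = ≮⇒≥ λ r<s →
    <⇒≱ 3s<2r (≤-trans (*-monoʳ-≤ 2 (<⇒≤ r<s)) (*-monoˡ-≤ s (s≤s (s≤s (z≤n {1})))))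
... | t , refl = t , ≤-refl ,
  +-cancelʳ-< (s * s + s * s + s * t + s * t) (t * s + s * s) (t * t) (begin-strict
  t * s + s * s + (s * s + s * s + s * t + s * t) ≡⟨ solve (s ∷ t ∷ []) ⟩
  3 * (s + t) * s                                 <⟨ gt ⟩
  (s + t) * (s + t) + s * s                       ≡⟨ solve (s ∷ t ∷ []) ⟩
  t * t + (s * s + s * s + s * t + s * t)         ∎)
  where open ≤-Reasoning

module MexSequence (ℓ : ℕ) (a b : ℕ → ℕ) (seq : IsSeq ℓ a b) where

  a₀≡ : a 0 ≡ suc ℓ
  a₀≡ = trans (proj₁ seq) (+-comm ℓ 1)

  b≡ : ∀ n → b n ≡ a n + n + suc ℓ
  b≡ zero = begin
    b 0               ≡⟨ proj₁ (proj₂ seq) ⟩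
    2 * ℓ + 2         ≡⟨ solve (ℓ ∷ []) ⟩
    suc ℓ + 0 + suc ℓ ≡⟨ cong (λ a₀ → a₀ + 0 + suc ℓ) (sym a₀≡) ⟩
    a 0 + 0 + suc ℓ   ∎
    where open ≡-Reasoning
  b≡ (suc n) = begin
    b (suc n)                       ≡⟨ proj₂ (proj₂ (proj₂ seq) (suc n) (s≤s z≤n)) ⟩
    a (suc n) + suc n + ℓ + 1       ≡⟨ +-assoc (a (suc n) + suc n) ℓ 1 ⟩
    a (suc n) + suc n + (ℓ + 1)     ≡⟨ cong (a (suc n) + suc n +_) (+-comm ℓ 1) ⟩
    a (suc n) + suc n + suc ℓ       ∎
    where open ≡-Reasoning

  isMex : ∀ n → IsMex ℓ a b n (a n)
  isMex zero = a₀∉ , below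
    where
    a₀∉ : ¬ InS ℓ a b 0 (a 0)
    a₀∉ (inj₁ a₀≤ℓ)        = contradiction (subst (_≤ ℓ) a₀≡ a₀≤ℓ) (1+n≰n)
    a₀∉ (inj₂ (_ , () , _))
    below : ∀ k → k < a 0 → InS ℓ a b 0 k
    below k k<a₀ = inj₁ (≤-pred (subst (k <_) a₀≡ k<a₀))
  isMex (suc n) = proj₁ (proj₂ (proj₂ seq) (suc n) (s≤s z≤n))

  ℓ<a : ∀ n → ℓ < a n
  ℓ<a n = ≰⇒> λ a≤ℓ → proj₁ (isMex n) (inj₁ a≤ℓ)

  InS-mono : ∀ {n m y} → n ≤ m → InS ℓ a b n y → InS ℓ a b m y
  InS-mono _   (inj₁ y≤ℓ)            = inj₁ y≤ℓ
  InS-mono n≤m (inj₂ (i , i<n , y≡)) = inj₂ (i , <-≤-trans i<n n≤m , y≡)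

  a-increasing : StrictlyIncreasing a
  a-increasing n = ≰⇒> λ a₁≤a → proj₁ (isMex (suc n)) (taken a₁≤a)
    where
    taken : a (suc n) ≤ a n → InS ℓ a b (suc n) (a (suc n))
    taken a₁≤a with m≤n⇒m<n∨m≡n a₁≤a
    ... | inj₁ a₁<a = InS-mono (n≤1+n n) (proj₂ (isMex n) (a (suc n)) a₁<a)
    ... | inj₂ a₁≡a = inj₂ (n , n<1+n n , inj₁ a₁≡a)

  a<b : ∀ n → a n < b n
  a<b n = subst (a n <_) (sym (b≡ n)) (≤-<-trans (m≤m+n (a n) n) (m<m+n (a n + n) z<s))

  b-increasing : StrictlyIncreasing b
  b-increasing n = subst₂ _<_ (sym (b≡ n)) (sym (b≡ (suc n)))
                     (+-monoˡ-< (suc ℓ) (+-mono-< (a-increasing n) (n<1+n n)))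

  a≢b : ∀ m i → a m ≢ b i
  a≢b m i am≡bi with i <? m
  ... | yes i<m = proj₁ (isMex m) (inj₂ (i , i<m , inj₂ am≡bi))
  ... | no i≮m  = <-irrefl am≡bi (≤-<-trans (increasing-≤ a-increasing (≮⇒≥ i≮m)) (a<b i))

  gap⊆b : ∀ n y → a n < y → y < a (suc n) → ∃[ i ] y ≡ b i
  gap⊆b n y an<y y<a₁ with proj₂ (isMex (suc n)) y y<a₁
  ... | inj₁ y≤ℓ              = contradiction (<-trans (ℓ<a n) an<y) (≤⇒≯ y≤ℓ)
  ... | inj₂ (i , i<1+n , inj₁ y≡ai) =
    contradiction (subst (_≤ a n) (sym y≡ai) (increasing-≤ a-increasing (≤-pred i<1+n)))
                  (<⇒≱ an<y)
  ... | inj₂ (i , _ , inj₂ y≡bi) = i , y≡bi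

  a-rank : ∀ n → ∃[ k ] a n ≡ n + suc ℓ + k × Rank b k (a n)
  a-rank zero = 0 , trans a₀≡ (sym (+-identityʳ (suc ℓ))) , (λ _ ()) , <⇒≤ (a<b 0)
  a-rank (suc n) with a-rank n | m≤n⇒∃[o]m+o≡n (a-increasing n)
  ... | k , a≡ , rank | t , a+t≡a₁ =
    t + k , a₁≡ , subst (Rank b (t + k)) fill
      (rank-fill b-increasing (gap⊆b n) (rank-skip rank (a≢b n k)) t (≤-reflexive fill))
    where
    fill : t + suc (a n) ≡ a (suc n)
    fill = trans (+-comm t (suc (a n))) a+t≡a₁
    a₁≡ : a (suc n) ≡ suc n + suc ℓ + (t + k)
    a₁≡ = begin
      a (suc n)                ≡⟨ sym fill ⟩
      t + suc (a n)            ≡⟨ cong (λ an → t + suc an) a≡ ⟩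
      t + suc (n + suc ℓ + k)  ≡⟨ solve (t ∷ n ∷ ℓ ∷ k ∷ []) ⟩
      suc n + suc ℓ + (t + k)  ∎
      where open ≡-Reasoning

module Rates (c : ℕ) (a b : ℕ → ℕ) (b≡ : ∀ n → b n ≡ a n + n + c)
             (a-rank : ∀ n → ∃[ k ] a n ≡ n + c + k × Rank b k (a n)) where
  open ≤-Reasoning

  n≤a : ∀ n → n ≤ a n
  n≤a n with a-rank n
  ... | k , a≡ , _ = subst (n ≤_) (sym a≡) (≤-trans (m≤m+n n c) (m≤m+n (n + c) k))

  n+a≤b : ∀ n → n + a n ≤ b n
  n+a≤b n = subst (n + a n ≤_) (sym (b≡ n))
    (≤-trans (≤-reflexive (+-comm n (a n))) (m≤m+n (a n + n) c))

  rank≤ : ∀ {n k} → Rank b k (a n) → k ≤ n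
  rank≤ {n} (below , _) = ≮⇒≥ λ n<k → <⇒≱ (below n n<k) (≤-trans (m≤n+m (a n) n) (n+a≤b n))

  rank⇒≤a : ∀ {n k} → a n ≡ n + c + k → Rank b k (a n) → n ≤ a k
  rank⇒≤a {n} {k} a≡ (_ , an≤bk) = +-cancelʳ-≤ (c + k) n (a k) (begin
    n + (c + k)    ≡⟨ sym (+-assoc n c k) ⟩
    n + c + k      ≡⟨ sym a≡ ⟩
    a n            ≤⟨ an≤bk ⟩
    b k            ≡⟨ b≡ k ⟩
    a k + k + c    ≡⟨ +-assoc (a k) k c ⟩
    a k + (k + c)  ≡⟨ cong (a k +_) (+-comm k c) ⟩
    a k + (c + k)  ∎)

  rank⇒a≤ : ∀ {n k} → a n ≡ n + c + suc k → Rank b (suc k) (a n) → a k ≤ n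
  rank⇒a≤ {n} {k} a≡ (below , _) = +-cancelʳ-≤ (c + k) (a k) n (≤-pred (begin-strict
    a k + (c + k)        ≡⟨ cong (a k +_) (+-comm c k) ⟩
    a k + (k + c)        ≡⟨ sym (+-assoc (a k) k c) ⟩
    a k + k + c          ≡⟨ sym (b≡ k) ⟩
    b k                  <⟨ below k (n<1+n k) ⟩
    a n                  ≡⟨ a≡ ⟩
    n + c + suc k        ≡⟨ +-suc (n + c) k ⟩
    suc (n + c + k)      ≡⟨ cong suc (+-assoc n c k) ⟩
    suc (n + (c + k))    ∎))

  lowerBound-≤ : ∀ p q → p ≤ q → LinearLowerBound a p q
  lowerBound-≤ p q p≤q = 0 , λ n → begin
    p * n        ≤⟨ *-mono-≤ p≤q (n≤a n) ⟩
    q * a n      ≤⟨ m≤m+n (q * a n) 0 ⟩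
    q * a n + 0  ∎

  upperBound-2* : ∀ p q → 2 * q ≤ p → LinearUpperBound a p q
  upperBound-2* p q 2q≤p = q * c , bound
    where
    bound : ∀ n → q * a n ≤ p * n + q * c
    bound n with a-rank n
    ... | k , a≡ , rank = begin
      q * a n            ≡⟨ cong (q *_) a≡ ⟩
      q * (n + c + k)    ≤⟨ *-monoʳ-≤ q (+-monoʳ-≤ (n + c) (rank≤ rank)) ⟩
      q * (n + c + n)    ≡⟨ solve (q ∷ n ∷ c ∷ []) ⟩
      2 * q * n + q * c  ≤⟨ +-monoˡ-≤ (q * c) (*-monoˡ-≤ n 2q≤p) ⟩
      p * n + q * c      ∎

  lowerBound-step : ∀ q r → LinearUpperBound a q r → LinearLowerBound a (q + r) q
  lowerBound-step q r (D , upper) = D , bound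
    where
    bound : ∀ n → (q + r) * n ≤ q * a n + D
    bound n with a-rank n
    ... | k , a≡ , rank = begin
      (q + r) * n              ≡⟨ *-distribʳ-+ n q r ⟩
      q * n + r * n            ≤⟨ +-monoʳ-≤ (q * n) (*-monoʳ-≤ r (rank⇒≤a a≡ rank)) ⟩
      q * n + r * a k          ≤⟨ +-monoʳ-≤ (q * n) (upper k) ⟩
      q * n + (q * k + D)      ≤⟨ m≤m+n _ (q * c) ⟩
      q * n + (q * k + D) + q * c ≡⟨ solve (q ∷ n ∷ k ∷ D ∷ c ∷ []) ⟩
      q * (n + c + k) + D      ≡⟨ cong (λ an → q * an + D) (sym a≡) ⟩
      q * a n + D              ∎

  upperBound-step : ∀ q r → LinearLowerBound a q r → LinearUpperBound a (q + r) q
  upperBound-step q r (C , lower) = q * suc c + C , bound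
    where
    rank-term : ∀ {n k} → a n ≡ n + c + k → Rank b k (a n) → q * k ≤ q + (r * n + C)
    rank-term {k = zero}  _  _    = ≤-trans (≤-reflexive (*-zeroʳ q)) z≤n
    rank-term {n} {suc k} a≡ rank = begin
      q * suc k             ≡⟨ *-suc q k ⟩
      q + q * k             ≤⟨ +-monoʳ-≤ q (lower k) ⟩
      q + (r * a k + C)     ≤⟨ +-monoʳ-≤ q (+-monoˡ-≤ C (*-monoʳ-≤ r (rank⇒a≤ a≡ rank))) ⟩
      q + (r * n + C)       ∎
    bound : ∀ n → q * a n ≤ (q + r) * n + (q * suc c + C)
    bound n with a-rank n
    ... | k , a≡ , rank = begin
      q * a n                         ≡⟨ cong (q *_) a≡ ⟩
      q * (n + c + k)                 ≡⟨ *-distribˡ-+ q (n + c) k ⟩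
      q * (n + c) + q * k             ≤⟨ +-monoʳ-≤ (q * (n + c)) (rank-term a≡ rank) ⟩
      q * (n + c) + (q + (r * n + C)) ≡⟨ solve (q ∷ r ∷ n ∷ c ∷ C ∷ []) ⟩
      (q + r) * n + (q * suc c + C)   ∎

  -- N is fuel: the Euclid step replaces the numerator p by the smaller q.
  lowerBound-φ : ∀ p q N → p < N → PhiLower p q → LinearLowerBound a p q
  upperBound-φ : ∀ p q N → p < N → PhiUpper p q → LinearUpperBound a p q

  lowerBound-φ _ _ zero () _
  lowerBound-φ p q (suc N) (s≤s p≤N) lt with p ≤? q
  ... | yes p≤q = lowerBound-≤ p q p≤q
  ... | no p≰q with m≤n⇒∃[o]m+o≡n (<⇒≤ (≰⇒> p≰q))
  ... | r , refl = lowerBound-step q r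
    (upperBound-φ q r N (<-≤-trans (≰⇒> p≰q) p≤N) (phiLower-euclid q r lt))

  upperBound-φ _ _ zero () _
  upperBound-φ p q (suc N) (s≤s p≤N) gt with 2 * q ≤? p
  ... | yes 2q≤p = upperBound-2* p q 2q≤p
  ... | no _ with m≤n⇒∃[o]m+o≡n (<⇒≤ (phiUpper⇒< p q gt))
  ... | r , refl = upperBound-step q r
    (lowerBound-φ q r N (<-≤-trans (phiUpper⇒< p q gt) p≤N) (phiUpper-euclid q r gt))

  a-above : ∀ p q → PhiLower p q → Eventually (λ n → p * n < q * a n)
  a-above p q lt = lowerBound⇒eventually-< p q m
    (lowerBound-φ (p * m + 1) (q * m) _ (n<1+n _) (phiLower-sharpen p q m (n<1+n (p + p)) lt))
    where m = suc (p + p)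

  a-below : ∀ p q → PhiUpper p q → ∀ E → Eventually (λ n → q * a n + E < p * n)
  a-below p q gt = upperBound⇒eventually-< p q m n≤a
    (upperBound-φ (p * m) (q * m + 1) _ (n<1+n _) (phiUpper-sharpen p q m (n<1+n (p + q + q)) gt))
    where m = suc (p + q + q)

  b-above : ∀ r s → 0 < s → Phi2Lower r s → Eventually (λ n → r * n < s * b n)
  b-above r s 0<s lt = shift (phi2Lower⇒phiLower r s 0<s lt)
    where
    shift : ∃[ t ] r ≤ s + t × PhiLower t s → Eventually (λ n → r * n < s * b n)
    shift (t , r≤s+t , low) = N , λ n N≤n → begin-strict
      r * n            ≤⟨ *-monoˡ-≤ n r≤s+t ⟩
      (s + t) * n      ≡⟨ *-distribʳ-+ n s t ⟩
      s * n + t * n    <⟨ +-monoʳ-< (s * n) (above n N≤n) ⟩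
      s * n + s * a n  ≡⟨ sym (*-distribˡ-+ s n (a n)) ⟩
      s * (n + a n)    ≤⟨ *-monoʳ-≤ s (n+a≤b n) ⟩
      s * b n          ∎
      where
      N = proj₁ (a-above t s low)
      above = proj₂ (a-above t s low)

  b-below : ∀ r s → Phi2Upper r s → Eventually (λ n → s * b n < r * n)
  b-below r s gt = shift (phi2Upper⇒phiUpper r s gt)
    where
    distrib : ∀ {n} A → s * (A + n + c) ≡ s * n + (s * A + s * c)
    distrib {n} A = solve (s ∷ A ∷ n ∷ c ∷ [])
    shift : ∃[ t ] s + t ≤ r × PhiUpper t s → Eventually (λ n → s * b n < r * n)
    shift (t , s+t≤r , up) = N , λ n N≤n → begin-strict
      s * b n                   ≡⟨ cong (s *_) (b≡ n) ⟩
      s * (a n + n + c)         ≡⟨ distrib (a n) ⟩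
      s * n + (s * a n + s * c) <⟨ +-monoʳ-< (s * n) (below n N≤n) ⟩
      s * n + t * n             ≡⟨ sym (*-distribʳ-+ n s t) ⟩
      (s + t) * n               ≤⟨ *-monoˡ-≤ n s+t≤r ⟩
      r * n                     ∎
      where
      N = proj₁ (a-below t s up (s * c))
      below = proj₂ (a-below t s up (s * c))

  a-ratio : RatioTendsTo a PhiLower PhiUpper
  a-ratio p q _ = a-above p q , λ gt → let N , below = a-below p q gt 0 in
    N , λ n N≤n → subst (_< p * n) (+-identityʳ (q * a n)) (below n N≤n)

  b-ratio : RatioTendsTo b Phi2Lower Phi2Upper
  b-ratio r s s≥1 = b-above r s s≥1 , b-below r s

corollary20 : (ℓ : ℕ) → ℓ ≥ 1 → (a b : ℕ → ℕ) → IsSeq ℓ a b →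
    RatioTendsTo a PhiLower PhiUpper × RatioTendsTo b Phi2Lower Phi2Upper
corollary20 ℓ _ a b seq = a-ratio , b-ratio
  where
  open MexSequence ℓ a b seq using (b≡; a-rank)
  open Rates (suc ℓ) a b b≡ a-rank
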